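{- Let $\Sigma$ be a finite alphabet, let $S=\langle (s_1,t_1),(s_2,t_2),\ldots\rangle$ be a sequence of events with $s_i\in\Sigma$ and strictly increasing timestamps, let $e=\langle\phi_1,\ldots,\phi_k\rangle$ be a serial episode and $\tau>0$ a time constraint. Suppose the OccMap $OM(e^\tau)=[L_1,\ldots,L_k]$ is maintained according to the list update strategy, and at a moment when $L_k$ is non-empty the occurrence validation procedure (described in the context) produces the minimal occurrence $Occ_{OPT}(e,S)=\langle t_1,\ldots,t_k\rangle$ with $t_1<\cdots<t_k$. If $t_k-t_1>\tau$, then no minimal occurrence $\langle t_1',\ldots,t_k'\rangle$ of $e$ in $S$ with $t_k'>t_k$ and with $t_i'\le t_i$ for some $i<k$ satisfies the time constraint, i.e. every such minimal occurrence has $t_k'-t_1'>\tau$.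
   Context: A serial episode $e=\langle\phi_1,\ldots,\phi_k\rangle$ is a totally ordered list of events from $\Sigma$. An occurrence of $e$ in $S$ is a tuple of timestamps $\langle x_1,\ldots,x_k\rangle$ with $x_1<\cdots<x_k$ such that the event at timestamp $x_i$ in $S$ is $\phi_i$. An occurrence $\langle x_1,\ldots,x_k\rangle$ is minimal if there is no other occurrence $\langle x_1',\ldots,x_k'\rangle$ with $x_1'\ge x_1$ and $x_k'\le x_k$. The time-constrained episode $e^\tau$ requires occurrences with $x_k-x_1\le\tau$. OccMap: $k$ lists $L_1,\ldots,L_k$ of timestamps ($L_i$ corresponds to $\phi_i$) and an integer $\ell$. List update strategy: initially all lists empty and $\ell=1$; when $(s,t)$ arrives, for every $j\le\min(\ell,k)$ ($\ell$ as before this event) with $\phi_j=s$, append $t$ to the end of $L_j$; then set $\ell$ to the smallest index of an empty list, or $k+1$ if none is empty. Occurrence validation (performed when $L_k$ becomes non-empty): set $t_k$ to the first entry of $L_k$; for $i=k-1$ down to $1$, set $t_i$ to the largest entry of $L_i$ that is smaller than $t_{i+1}$. -}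

module Defs where

open import Data.Nat using (ℕ; zero; suc; _<_; _≤_; _<?_)
open import Data.Fin as Fin using (Fin; toℕ; fromℕ; inject₁)
open import Data.Bool using (Bool; true; false; if_then_else_; _∧_)
open import Data.List using (List; []; _∷_; _++_; [_]; foldl)
open import Data.List.Membership.Propositional using (_∈_)
open import Data.List.Relation.Unary.Linked using (Linked)
open import Data.Vec using (Vec; lookup; tabulate; replicate)
open import Data.Product using (_×_; _,_; proj₁; proj₂; ∃; Σ)
open import Relation.Nullary using (¬_; does)
open import Relation.Binary.PropositionalEquality using (_≡_; _≢_)

Event : ℕ → Set
Event m = Fin m × ℕ

StrictTimes : ∀ {m} → List (Event m) → Set
StrictTimes = Linked (λ a b → proj₂ a < proj₂ b)

-- A serial episode ⟨φ₁,…,φ_k⟩ with k = suc n ≥ 1, indexed 0-based by Fin (suc n).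
Episode : ℕ → ℕ → Set
Episode m k = Vec (Fin m) k

-- Occurrences (0-based: index i stands for the paper's i+1; fromℕ n is k)

IsOcc : ∀ {m n} → Episode m (suc n) → List (Event m) → (Fin (suc n) → ℕ) → Set
IsOcc {n = n} e S x =
  (∀ (i : Fin n) → x (inject₁ i) < x (Fin.suc i)) ×
  (∀ (i : Fin (suc n)) → (lookup e i , x i) ∈ S)

IsMinOcc : ∀ {m n} → Episode m (suc n) → List (Event m) → (Fin (suc n) → ℕ) → Set
IsMinOcc {n = n} e S x =
  IsOcc e S x ×
  ¬ (Σ (Fin (suc n) → ℕ) λ y →
       IsOcc e S y ×
       ((y Fin.zero , y (fromℕ n)) ≢ (x Fin.zero , x (fromℕ n))) ×
       x Fin.zero ≤ y Fin.zero × y (fromℕ n) ≤ x (fromℕ n))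

record OccMap (k : ℕ) : Set where
  constructor occMap
  field
    lists : Vec (List ℕ) k
    ell   : ℕ                -- ℓ (1-based)

-- smallest 1-based index of an empty list, or k+1 if none is empty
firstEmpty : ∀ {k} → Vec (List ℕ) k → ℕ
firstEmpty Vec.[] = 1
firstEmpty (List.[] Vec.∷ _) = 1
firstEmpty ((_ List.∷ _) Vec.∷ Ls) = suc (firstEmpty Ls)

initOccMap : ∀ k → OccMap k
initOccMap k = occMap (replicate k []) 1

-- On event (s,t): for every 1-based j ≤ min(ℓ,k) with φ_j = s, append t to L_j
-- (0-based index j satisfies toℕ j < ℓ); then reset ℓ.
updateOccMap : ∀ {m k} → Episode m k → OccMap k → Event m → OccMap k
updateOccMap e (occMap L ℓ) (s , t) = occMap L' (firstEmpty L')
  where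
  L' = tabulate λ j →
         if does (toℕ j <? ℓ) ∧ does (lookup e j Fin.≟ s)
         then lookup L j ++ [ t ]
         else lookup L j

runOccMap : ∀ {m k} → Episode m k → List (Event m) → OccMap k
runOccMap {k = k} e = foldl (updateOccMap e) (initOccMap k)

Validates : ∀ {n} → Vec (List ℕ) (suc n) → (Fin (suc n) → ℕ) → Set
Validates {n} L t =
  (∃ λ rest → lookup L (fromℕ n) ≡ t (fromℕ n) ∷ rest) ×
  (∀ (i : Fin n) →
     t (inject₁ i) ∈ lookup L (inject₁ i) ×
     t (inject₁ i) < t (Fin.suc i) ×
     (∀ x → x ∈ lookup L (inject₁ i) → x < t (Fin.suc i) → x ≤ t (inject₁ i)))

module Submission where

-- Let t be the tuple produced by occurrence validation on the OccMap
-- built from a prefix P of the stream P ++ R, and t′ an occurrence of e in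
-- P ++ R with t′ᵢ ≤ tᵢ for some i < k.  The comparison t′ⱼ ≤ tⱼ propagates
-- downwards: if t′ⱼ₊₁ ≤ tⱼ₊₁ then t′ⱼ < tⱼ₊₁, and tⱼ₊₁ is the timestamp of
-- an event of P, so the event (φⱼ , t′ⱼ) of the stream also lies in P; the
-- list update strategy records every component of an occurrence lying in
-- the processed prefix (completeness), hence t′ⱼ ∈ Lⱼ, and validation
-- picked tⱼ as the largest entry of Lⱼ below tⱼ₊₁, so t′ⱼ ≤ tⱼ.  Thus
-- t′₁ ≤ t₁, and together with t′ₖ > tₖ the window of t′ contains that of t,
-- which is longer than τ.

open import Defs
open import Data.Nat using (ℕ; suc; _<_; _≤_; _∸_)
open import Data.Fin using (Fin; zero; fromℕ; inject₁)
open import Data.List using (List; _++_)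
open import Data.Product using (∃)

open import Function using (_∘_)
open import Data.Nat using (zero; z≤n; s≤s; _<?_)
open import Data.Nat.Properties
  using (<-trans; <-irrefl; <-asym; <⇒≤; <-≤-trans; ∸-mono)
open import Data.Fin as F using (toℕ)
open import Data.Fin.Induction using (<-wellFounded)
open import Data.Fin.Relation.Unary.Top using (view; ‵fromℕ; ‵inj₁)
open import Data.Bool using (Bool; true; false; if_then_else_; _∧_)
open import Data.List using ([]; _∷_; [_]; foldl)
open import Data.List.Properties using (foldl-++; ++-assoc)
open import Data.List.Membership.Propositional using (_∈_)
open import Data.List.Membership.Propositional.Properties
  using (∈-++⁺ˡ; ∈-++⁺ʳ; ∈-++⁻; ∈-∃++)
open import Data.List.Relation.Unary.Any using (here; there)
import Data.List.Relation.Unary.All as All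
open import Data.List.Relation.Unary.AllPairs using (AllPairs; _∷_)
open import Data.List.Relation.Unary.Linked.Properties using (Linked⇒AllPairs)
open import Data.Vec using (Vec; lookup; replicate)
open import Data.Vec.Properties using (lookup∘tabulate; lookup-replicate)
open import Data.Product using (_,_; proj₁; proj₂)
open import Data.Sum using (_⊎_; inj₁; inj₂)
open import Data.Empty using (⊥-elim)
open import Relation.Nullary using (does)
open import Relation.Nullary.Decidable using (dec-true)
open import Induction.WellFounded using (Acc; acc)
open import Relation.Binary.PropositionalEquality
  using (_≡_; refl; sym; trans; subst)

module _ {m : ℕ} where

  Chronological : List (Event m) → Set
  Chronological = AllPairs (λ a b → proj₂ a < proj₂ b)

  chronological : ∀ {G} → StrictTimes G → Chronological G
  chronological = Linked⇒AllPairs <-trans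

  before-boundary : ∀ A {c C x} → Chronological (A ++ c ∷ C) →
                    x ∈ A ++ c ∷ C → proj₂ x < proj₂ c → x ∈ A
  before-boundary []      _         (here refl) x<c = ⊥-elim (<-irrefl refl x<c)
  before-boundary []      (c≺ ∷ _)  (there x∈)  x<c = ⊥-elim (<-asym x<c (All.lookup c≺ x∈))
  before-boundary (_ ∷ A) _         (here refl) _   = here refl
  before-boundary (_ ∷ A) (_ ∷ ch)  (there x∈)  x<c = there (before-boundary A ch x∈ x<c)

  before-prefix : ∀ A {C a x} → Chronological (A ++ C) →
                  x ∈ A ++ C → a ∈ A → proj₂ x < proj₂ a → x ∈ A
  before-prefix (_ ∷ A) _        (here refl) _           _   = here refl
  before-prefix (_ ∷ A) (b≺ ∷ _) (there x∈)  (here refl) x<b = ⊥-elim (<-asym x<b (All.lookup b≺ x∈))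
  before-prefix (_ ∷ A) (_ ∷ ch) (there x∈)  (there a∈)  x<a = there (before-prefix A ch x∈ a∈ x<a)

firstEmpty-beyond : ∀ {k} (L : Vec (List ℕ) k) (j : Fin k) →
                    (∀ (j′ : Fin k) → toℕ j′ < toℕ j → ∃ λ x → x ∈ lookup L j′) →
                    toℕ j < firstEmpty L
firstEmpty-beyond ([] Vec.∷ L)      zero     _        = s≤s z≤n
firstEmpty-beyond ((_ ∷ _) Vec.∷ L) zero     _        = s≤s z≤n
firstEmpty-beyond ([] Vec.∷ L)      (F.suc j) nonEmpty with nonEmpty zero (s≤s z≤n)
... | _ , ()
firstEmpty-beyond ((_ ∷ _) Vec.∷ L) (F.suc j) nonEmpty =
  s≤s (firstEmpty-beyond L j (λ j′ j′<j → nonEmpty (F.suc j′) (s≤s j′<j)))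

firstEmpty-init : ∀ k → firstEmpty (replicate {A = List ℕ} k []) ≡ 1
firstEmpty-init zero    = refl
firstEmpty-init (suc k) = refl

appendIf : Bool → List ℕ → ℕ → List ℕ
appendIf b xs t = if b then xs ++ [ t ] else xs

appendIf-grows : ∀ b xs t {x} → x ∈ xs → x ∈ appendIf b xs t
appendIf-grows true  xs t x∈ = ∈-++⁺ˡ x∈
appendIf-grows false xs t x∈ = x∈

appendIf-sound : ∀ b xs t {x} → x ∈ appendIf b xs t → x ∈ xs ⊎ x ≡ t
appendIf-sound true  xs t x∈ with ∈-++⁻ xs x∈
... | inj₁ x∈xs        = inj₁ x∈xs
... | inj₂ (here x≡t)  = inj₂ x≡t
appendIf-sound false xs t x∈ = inj₁ x∈

module _ {m k : ℕ} (e : Episode m k) where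

  lists : List (Event m) → Vec (List ℕ) k
  lists = OccMap.lists ∘ runOccMap e

  lookup-update : ∀ L ℓ s t j →
    lookup (OccMap.lists (updateOccMap e (occMap L ℓ) (s , t))) j ≡
    appendIf (does (toℕ j <? ℓ) ∧ does (lookup e j F.≟ s)) (lookup L j) t
  lookup-update L ℓ s t j = lookup∘tabulate _ j

  update-grows : ∀ M a j {x} → x ∈ lookup (OccMap.lists M) j →
                 x ∈ lookup (OccMap.lists (updateOccMap e M a)) j
  update-grows (occMap L ℓ) (s , t) j x∈ rewrite lookup-update L ℓ s t j =
    appendIf-grows _ (lookup L j) t x∈

  update-sound : ∀ M a j {x} → x ∈ lookup (OccMap.lists (updateOccMap e M a)) j →
                 x ∈ lookup (OccMap.lists M) j ⊎ x ≡ proj₂ a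
  update-sound (occMap L ℓ) (s , t) j x∈ rewrite lookup-update L ℓ s t j =
    appendIf-sound _ (lookup L j) t x∈

  update-admits : ∀ L ℓ j t → toℕ j < ℓ →
                  t ∈ lookup (OccMap.lists (updateOccMap e (occMap L ℓ) (lookup e j , t))) j
  update-admits L ℓ j t j<ℓ
    rewrite lookup-update L ℓ (lookup e j) t j
          | dec-true (toℕ j <? ℓ) j<ℓ | dec-true (lookup e j F.≟ lookup e j) refl
    = ∈-++⁺ʳ (lookup L j) (here refl)

  fold-grows : ∀ M B j {x} → x ∈ lookup (OccMap.lists M) j →
               x ∈ lookup (OccMap.lists (foldl (updateOccMap e) M B)) j
  fold-grows M []      j x∈ = x∈
  fold-grows M (a ∷ B) j x∈ = fold-grows (updateOccMap e M a) B j (update-grows M a j x∈)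

  fold-sound : ∀ M B j {x} → x ∈ lookup (OccMap.lists (foldl (updateOccMap e) M B)) j →
               x ∈ lookup (OccMap.lists M) j ⊎ ∃ λ s → (s , x) ∈ B
  fold-sound M []      j x∈ = inj₁ x∈
  fold-sound M (a ∷ B) j x∈ with fold-sound (updateOccMap e M a) B j x∈
  ... | inj₂ (s , sx∈B) = inj₂ (s , there sx∈B)
  ... | inj₁ x∈M′ with update-sound M a j x∈M′
  ...   | inj₁ x∈M  = inj₁ x∈M
  ...   | inj₂ refl = inj₂ (proj₁ a , here refl)

  run-sound : ∀ B j {x} → x ∈ lookup (lists B) j → ∃ λ s → (s , x) ∈ B
  run-sound B j x∈ with fold-sound (initOccMap k) B j x∈
  ... | inj₂ event = event
  ... | inj₁ x∈[] with subst (_ ∈_) (lookup-replicate j []) x∈[]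
  ...   | ()

  fold-ell : ∀ M B → OccMap.ell M ≡ firstEmpty (OccMap.lists M) →
             OccMap.ell (foldl (updateOccMap e) M B) ≡
             firstEmpty (OccMap.lists (foldl (updateOccMap e) M B))
  fold-ell M []      ℓ≡ = ℓ≡
  fold-ell M (a ∷ B) _  = fold-ell (updateOccMap e M a) B refl

  run-ell : ∀ B → OccMap.ell (runOccMap e B) ≡ firstEmpty (lists B)
  run-ell B = fold-ell (initOccMap k) B (sym (firstEmpty-init k))

occurrence-increasing : ∀ {n} (y : Fin (suc n) → ℕ) →
                        (∀ (i : Fin n) → y (inject₁ i) < y (F.suc i)) →
                        ∀ j′ j → toℕ j′ < toℕ j → y j′ < y j
occurrence-increasing y incr j′ zero ()
occurrence-increasing y incr zero (F.suc zero) _ = incr zero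
occurrence-increasing {suc n} y incr zero (F.suc (F.suc j)) _ =
  <-trans (incr zero) (occurrence-increasing (y ∘ F.suc) (incr ∘ F.suc) zero (F.suc j) (s≤s z≤n))
occurrence-increasing {suc n} y incr (F.suc j′) (F.suc j) (s≤s j′<j) =
  occurrence-increasing (y ∘ F.suc) (incr ∘ F.suc) j′ j j′<j

-- By induction on j: the earlier events of y precede the j-th one, so by
-- induction they are recorded before it arrives; hence ℓ > j at that moment.
occurrence-recorded : ∀ {m n} (e : Episode m (suc n)) {G : List (Event m)} →
  Chronological G → (y : Fin (suc n) → ℕ) → IsOcc e G y →
  ∀ j A {C} → A ++ C ≡ G → (lookup e j , y j) ∈ A → y j ∈ lookup (lists e A) j
occurrence-recorded e {G} chG y (incr , inG) j = recorded j (<-wellFounded j)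
  where
  recorded : ∀ j → Acc F._<_ j → ∀ A {C} → A ++ C ≡ G →
             (lookup e j , y j) ∈ A → y j ∈ lookup (lists e A) j
  recorded j (acc earlier) A {C} A++C≡G ev∈A with ∈-∃++ ev∈A
  ... | A₀ , B , refl =
    subst (λ M → y j ∈ lookup (OccMap.lists M) j)
          (sym (foldl-++ (updateOccMap e) (initOccMap _) A₀ (ev ∷ B)))
          (fold-grows e (updateOccMap e (runOccMap e A₀) ev) B j
             (update-admits e (lists e A₀) _ j (y j) j<ℓ))
    where
    ev = (lookup e j , y j)
    split : A₀ ++ (ev ∷ B ++ C) ≡ G
    split = trans (sym (++-assoc A₀ (ev ∷ B) C)) A++C≡G
    earlier-in-A₀ : ∀ j′ → toℕ j′ < toℕ j → (lookup e j′ , y j′) ∈ A₀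
    earlier-in-A₀ j′ j′<j =
      before-boundary A₀ (subst Chronological (sym split) chG)
        (subst (_ ∈_) (sym split) (inG j′)) (occurrence-increasing y incr j′ j j′<j)
    j<ℓ : toℕ j < OccMap.ell (runOccMap e A₀)
    j<ℓ = subst (toℕ j <_) (sym (run-ell e A₀))
            (firstEmpty-beyond (lists e A₀) j λ j′ j′<j →
               y j′ , recorded j′ (earlier j′<j) A₀ split (earlier-in-A₀ j′ j′<j))

module _ {n : ℕ} {L : Vec (List ℕ) (suc n)} {t : Fin (suc n) → ℕ} (val : Validates L t) where

  validated-∈ : ∀ j → t j ∈ lookup L j
  validated-∈ j with view j
  ... | ‵fromℕ           = subst (t (fromℕ n) ∈_) (sym (proj₂ (proj₁ val))) (here refl)
  ... | ‵inj₁ {i = i} _  = proj₁ (proj₂ val i)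

  validated-max : ∀ i x → x ∈ lookup L (inject₁ i) → x < t (F.suc i) → x ≤ t (inject₁ i)
  validated-max i = proj₂ (proj₂ (proj₂ val i))

descend : ∀ {n} (Q : Fin (suc n) → Set) → (∀ k → Q (F.suc k) → Q (inject₁ k)) →
          ∀ j → Q j → Q zero
descend Q step zero      q = q
descend {suc n} Q step (F.suc j) q = step zero (descend (Q ∘ F.suc) (step ∘ F.suc) j q)

validation-dominates : ∀ {m n} (e : Episode m (suc n)) (P R : List (Event m)) →
  StrictTimes (P ++ R) → (t : Fin (suc n) → ℕ) → Validates (lists e P) t →
  (y : Fin (suc n) → ℕ) → IsOcc e (P ++ R) y →
  (∃ λ (i : Fin n) → y (inject₁ i) ≤ t (inject₁ i)) → y zero ≤ t zero
validation-dominates e P R strPR t val y occ@(incr , inG) (i , yᵢ≤tᵢ) =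
  descend (λ j → y j ≤ t j) step (inject₁ i) yᵢ≤tᵢ
  where
  ch = chronological strPR
  step : ∀ k → y (F.suc k) ≤ t (F.suc k) → y (inject₁ k) ≤ t (inject₁ k)
  step k yₖ₊₁≤tₖ₊₁ = validated-max {L = lists e P} {t} val k (y (inject₁ k)) recorded yₖ<tₖ₊₁
    where
    yₖ<tₖ₊₁ = <-≤-trans (incr k) yₖ₊₁≤tₖ₊₁
    inP : (lookup e (inject₁ k) , y (inject₁ k)) ∈ P
    inP = before-prefix P ch (inG (inject₁ k))
            (proj₂ (run-sound e P (F.suc k) (validated-∈ {L = lists e P} {t} val (F.suc k)))) yₖ<tₖ₊₁
    recorded = occurrence-recorded e ch y occ (inject₁ k) P refl inP

theorem2 : ∀ {m n} (e : Episode m (suc n)) (τ : ℕ) → 0 < τ →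
    (P R : List (Event m)) → StrictTimes (P ++ R) →
    (t : Fin (suc n) → ℕ) → Validates (OccMap.lists (runOccMap e P)) t →
    τ < t (fromℕ n) ∸ t zero →
    (t′ : Fin (suc n) → ℕ) → IsMinOcc e (P ++ R) t′ →
    t (fromℕ n) < t′ (fromℕ n) →
    (∃ λ (i : Fin n) → t′ (inject₁ i) ≤ t (inject₁ i)) →
    τ < t′ (fromℕ n) ∸ t′ zero
theorem2 e τ _ P R strPR t val long t′ (occ , _) later below =
  <-≤-trans long (∸-mono (<⇒≤ later) (validation-dominates e P R strPR t val t′ occ below))
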